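{- Let $(X,d)$ be a $\mathcal V$-space which is (sequentially) Hausdorff. Then for all $x,y\in X$, $d(x,y)=\bot$ if and only if $x=y$.
   Context: $(\mathcal V,\otimes,e)$ is a quantale (complete lattice with bottom $\bot$ and top $\top$, with a commutative monoid structure $(\otimes,e)$ such that $x\otimes-$ preserves arbitrary joins). A $\mathcal V$-space is a set $X$ with a function $d\colon X\times X\to\mathcal V$ such that $d(x,x)\le\bot$ and $d(x,y)=d(y,x)$ for all $x,y$. A limit point of a sequence $(x_n)$ in $X$ is a point $y$ such that for every $r>\bot$ in $\mathcal V$ there is $N$ with $d(y,x_n)\le r$ for all $n\ge N$. $X$ is Hausdorff if any two limit points of the same sequence are equal. -}

module Defs where

open import Level using (Level; _⊔_; suc)
open import Data.Nat using (ℕ) renaming (_≤_ to _≤ℕ_)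
open import Data.Product using (_×_; ∃-syntax)
open import Relation.Nullary using (¬_)
open import Relation.Binary.Bundles using (Poset)
open import Relation.Binary.PropositionalEquality using (_≡_)
open import Algebra.Structures using (IsCommutativeMonoid)

record Quantale (c ℓ₁ ℓ₂ i : Level) : Set (suc (c ⊔ ℓ₁ ⊔ ℓ₂ ⊔ i)) where
  field
    poset : Poset c ℓ₁ ℓ₂
  open Poset poset public
  field
    ⋁        : {I : Set i} → (I → Carrier) → Carrier
    ⋁-upper  : {I : Set i} (f : I → Carrier) (j : I) → f j ≤ ⋁ f
    ⋁-least  : {I : Set i} (f : I → Carrier) (z : Carrier) →
               (∀ j → f j ≤ z) → ⋁ f ≤ z
    ⊥ᵥ       : Carrier
    ⊤ᵥ       : Carrier
    ⊥ᵥ-least : ∀ x → ⊥ᵥ ≤ x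
    ⊤ᵥ-great : ∀ x → x ≤ ⊤ᵥ
    _⊗_      : Carrier → Carrier → Carrier
    e        : Carrier
    ⊗-isCommutativeMonoid : IsCommutativeMonoid _≈_ _⊗_ e
    ⊗-distrib-⋁ : {I : Set i} (x : Carrier) (f : I → Carrier) →
                  (x ⊗ ⋁ f) ≈ ⋁ (λ j → x ⊗ f j)

  _>⊥ : Carrier → Set (ℓ₁ ⊔ ℓ₂)
  r >⊥ = (⊥ᵥ ≤ r) × ¬ (⊥ᵥ ≈ r)

record VSpace {c ℓ₁ ℓ₂ i} (V : Quantale c ℓ₁ ℓ₂ i) (a : Level)
       : Set (suc a ⊔ c ⊔ ℓ₁ ⊔ ℓ₂) where
  open Quantale V
  field
    X     : Set a
    d     : X → X → Carrier
    d-refl : ∀ x → d x x ≤ ⊥ᵥ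
    d-sym  : ∀ x y → d x y ≈ d y x

module _ {c ℓ₁ ℓ₂ i a} {V : Quantale c ℓ₁ ℓ₂ i} (S : VSpace V a) where
  open Quantale V
  open VSpace S

  IsLimitPoint : (ℕ → X) → X → Set (c ⊔ ℓ₁ ⊔ ℓ₂)
  IsLimitPoint s y = ∀ (r : Carrier) → r >⊥ →
    ∃[ N ] (∀ n → N ≤ℕ n → d y (s n) ≤ r)

  Hausdorff : Set (a ⊔ c ⊔ ℓ₁ ⊔ ℓ₂)
  Hausdorff = ∀ (s : ℕ → X) (y₁ y₂ : X) →
    IsLimitPoint s y₁ → IsLimitPoint s y₂ → y₁ ≡ y₂

{-# OPTIONS --safe #-}
module Submission where

-- If d x y = ⊥, the constant sequence at x has both x and y as limit points,
-- since every distance ≤ ⊥ lies below any r > ⊥; Hausdorffness then forces x = y.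

open import Defs
open import Level using (Level)
open import Function using (const)
open import Data.Product using (_×_; _,_; proj₁)
open import Data.Nat using (zero)
open import Relation.Binary.PropositionalEquality using (_≡_; refl)

module VSpaceProperties {c ℓ₁ ℓ₂ i a} {V : Quantale c ℓ₁ ℓ₂ i} (S : VSpace V a) where
  open Quantale V
  open VSpace S

  d-self≈⊥ : ∀ x → d x x ≈ ⊥ᵥ
  d-self≈⊥ x = antisym (d-refl x) (⊥ᵥ-least (d x x))

  ≤⊥⇒limitPoint-const : ∀ {x y} → d y x ≤ ⊥ᵥ → IsLimitPoint S (const x) y
  ≤⊥⇒limitPoint-const dyx≤⊥ r r>⊥ = zero , λ _ _ → trans dyx≤⊥ (proj₁ r>⊥)

  Hausdorff⇒d≈⊥⇒≡ : Hausdorff S → ∀ {x y} → d x y ≈ ⊥ᵥ → x ≡ y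
  Hausdorff⇒d≈⊥⇒≡ hausdorff {x} {y} dxy≈⊥ =
    hausdorff (const x) x y
      (≤⊥⇒limitPoint-const (d-refl x))
      (≤⊥⇒limitPoint-const (reflexive (Eq.trans (d-sym y x) dxy≈⊥)))

mainTheorem9 : ∀ {c ℓ₁ ℓ₂ i a : Level} (V : Quantale c ℓ₁ ℓ₂ i) (S : VSpace V a) →
    Hausdorff S → ∀ (x y : VSpace.X S) →
    (Quantale._≈_ V (VSpace.d S x y) (Quantale.⊥ᵥ V) → x ≡ y) ×
    (x ≡ y → Quantale._≈_ V (VSpace.d S x y) (Quantale.⊥ᵥ V))
mainTheorem9 V S hausdorff x y = Hausdorff⇒d≈⊥⇒≡ hausdorff , λ { refl → d-self≈⊥ x }
  where open VSpaceProperties S
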